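{- Let $X$ be a cubic vertex-transitive graph. If both $1$ and $-1$ are simple eigenvalues of (the adjacency matrix of) $X$, then $X$ is bipartite.
   Context: An eigenvalue of a graph is an eigenvalue of its adjacency matrix $A(X)$ (rows and columns indexed by the vertices). An eigenvalue is simple if its eigenspace is one-dimensional. -}

module Defs where

open import Data.Nat using (ℕ; zero; suc)
open import Data.Bool using (Bool; true; false; if_then_else_)
open import Data.Fin using (Fin; zero; suc)
open import Data.Fin.Permutation using (Permutation′; _⟨$⟩ʳ_)
open import Data.Rational using (ℚ; 0ℚ; _+_; _*_)
open import Data.Product using (Σ; ∃; _×_; _,_)
open import Relation.Binary.PropositionalEquality using (_≡_; _≢_)

record Graph : Set where
  field
    n      : ℕ
    adj    : Fin n → Fin n → Bool
    adj-sym     : ∀ i j → adj i j ≡ adj j i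
    adj-irrefl  : ∀ i → adj i i ≡ false
open Graph public

sumFin : (m : ℕ) → (Fin m → ℚ) → ℚ
sumFin zero    f = 0ℚ
sumFin (suc m) f = f zero + sumFin m (λ i → f (suc i))

countTrue : (m : ℕ) → (Fin m → Bool) → ℕ
countTrue zero    f = zero
countTrue (suc m) f = (if f zero then suc zero else zero) Data.Nat.+ countTrue m (λ i → f (suc i))

degree : (X : Graph) → Fin (n X) → ℕ
degree X i = countTrue (n X) (adj X i)

Cubic : Graph → Set
Cubic X = ∀ i → degree X i ≡ 3

IsAutomorphism : (X : Graph) → Permutation′ (n X) → Set
IsAutomorphism X σ = ∀ i j → adj X (σ ⟨$⟩ʳ i) (σ ⟨$⟩ʳ j) ≡ adj X i j

VertexTransitive : Graph → Set
VertexTransitive X = ∀ u v → Σ (Permutation′ (n X)) λ σ → IsAutomorphism X σ × (σ ⟨$⟩ʳ u ≡ v)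

Bipartite : Graph → Set
Bipartite X = Σ (Fin (n X) → Bool) λ c → ∀ i j → adj X i j ≡ true → c i ≢ c j

adjMatrix : (X : Graph) → Fin (n X) → Fin (n X) → ℚ
adjMatrix X i j = if adj X i j then Data.Rational.1ℚ else 0ℚ

mulVec : (X : Graph) → (Fin (n X) → ℚ) → Fin (n X) → ℚ
mulVec X v i = sumFin (n X) (λ j → adjMatrix X i j * v j)

InEigenspace : (X : Graph) → ℚ → (Fin (n X) → ℚ) → Set
InEigenspace X λ' v = ∀ i → mulVec X v i ≡ λ' * v i

NonZeroVec : {m : ℕ} → (Fin m → ℚ) → Set
NonZeroVec v = ∃ λ i → v i ≢ 0ℚ

SimpleEigenvalue : (X : Graph) → ℚ → Set
SimpleEigenvalue X λ' =
  Σ (Fin (n X) → ℚ) λ v → NonZeroVec v × InEigenspace X λ' v ×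
    (∀ w → InEigenspace X λ' w → ∃ λ c → ∀ i → w i ≡ c * v i)

-- An automorphism maps the eigenvector v of a simple eigenvalue to c·v, and since it only
-- permutes the entries of v, |c| = 1; on a vertex-transitive graph |v| is therefore constant
-- and v is, up to scaling, a ±1 vector. For the eigenvalue 1 of a cubic graph this means that
-- every vertex has exactly one neighbour of the opposite sign, and for −1 exactly two.
-- Colour each vertex by the product of its two signs. At every vertex the colour then changes
-- along all three edges or along exactly one, and which case occurs is invariant under
-- automorphisms, hence the same everywhere. In the first case the colouring is proper. In the
-- second, the ±1 colour vector is itself an eigenvector for 1, so by simplicity it is ± the
-- sign vector for 1; but then the sign vector for −1 is constant, and a constant vector has
-- eigenvalue 3.
{-# OPTIONS --safe #-}
module Submission where

open import Defs
open import Data.Rational using (1ℚ; -_)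
open import Data.Nat using (ℕ; zero; suc)
open import Data.Bool using (Bool; true; false; if_then_else_; _xor_)
open import Data.Bool.Properties using (xor-same)
open import Data.Bool.Solver using (module xor-∧-Solver)
open import Data.Fin using (Fin; zero; suc)
open import Data.Fin.Permutation using (Permutation′; _⟨$⟩ʳ_; _⟨$⟩ˡ_; inverseʳ)
open import Data.Rational using (ℚ; 0ℚ; _+_; _*_; ∣_∣; _≤_; _<_; _<?_; 1/_; NonZero; ≢-nonZero)
open import Data.Rational.Properties
open import Algebra.Bundles using (CommutativeRing)
import Algebra.Properties.Semiring.Sum as SemiringSum
open import Data.Product using (∃; _×_; _,_; proj₁)
open import Data.Sum using (_⊎_; inj₁; inj₂)
open import Data.List using (List; []; _∷_; length; map; foldr)
open import Data.List.Properties using (length-map; map-∘)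
open import Data.List.Membership.Propositional using (_∈_)
open import Data.List.Membership.Propositional.Properties using (∈-map⁺; ∈-map⁻)
open import Data.List.Relation.Unary.Any using (here; there)
open import Relation.Binary.PropositionalEquality
open import Relation.Nullary using (¬_; Dec; yes; no; does)
open import Data.Empty using (⊥-elim)
open import Algebra.Properties.Ring +-*-ring using (-1*x≈-x; -‿involutive)
open import Function using (_∘_)

private
  variable
    m : ℕ

module ℚSum = SemiringSum (CommutativeRing.semiring +-*-commutativeRing)

sumFin≡sum : ∀ m (f : Fin m → ℚ) → sumFin m f ≡ ℚSum.sum f
sumFin≡sum zero    f = refl
sumFin≡sum (suc m) f = cong (f zero +_) (sumFin≡sum m (f ∘ suc))

sumFin-cong : {f g : Fin m → ℚ} → f ≗ g → sumFin m f ≡ sumFin m g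
sumFin-cong {m} {f} {g} f≗g = begin
  sumFin m f    ≡⟨ sumFin≡sum m f ⟩
  ℚSum.sum f    ≡⟨ ℚSum.sum-cong-≗ f≗g ⟩
  ℚSum.sum g    ≡⟨ sumFin≡sum m g ⟨
  sumFin m g    ∎
  where open ≡-Reasoning

sumFin-permute : (f : Fin m → ℚ) (π : Permutation′ m) → sumFin m (f ∘ (π ⟨$⟩ʳ_)) ≡ sumFin m f
sumFin-permute {m} f π = begin
  sumFin m (f ∘ (π ⟨$⟩ʳ_))    ≡⟨ sumFin≡sum m _ ⟩
  ℚSum.sum (f ∘ (π ⟨$⟩ʳ_))    ≡⟨ ℚSum.sum-permute f π ⟨
  ℚSum.sum f                  ≡⟨ sumFin≡sum m f ⟨
  sumFin m f                  ∎
  where open ≡-Reasoning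

sumFin-*ˡ : ∀ c (f : Fin m → ℚ) → sumFin m (λ i → c * f i) ≡ c * sumFin m f
sumFin-*ˡ {m} c f = begin
  sumFin m (λ i → c * f i)    ≡⟨ sumFin≡sum m _ ⟩
  ℚSum.sum (λ i → c * f i)    ≡⟨ ℚSum.*-distribˡ-sum c f ⟨
  c * ℚSum.sum f              ≡⟨ cong (c *_) (sumFin≡sum m f) ⟨
  c * sumFin m f              ∎
  where open ≡-Reasoning

sumFin-*ʳ : ∀ c (f : Fin m → ℚ) → sumFin m (λ i → f i * c) ≡ sumFin m f * c
sumFin-*ʳ {m} c f = begin
  sumFin m (λ i → f i * c)    ≡⟨ sumFin≡sum m _ ⟩
  ℚSum.sum (λ i → f i * c)    ≡⟨ ℚSum.*-distribʳ-sum c f ⟨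
  ℚSum.sum f * c              ≡⟨ cong (_* c) (sumFin≡sum m f) ⟨
  sumFin m f * c              ∎
  where open ≡-Reasoning

0≤sumFin : (f : Fin m → ℚ) → (∀ i → 0ℚ ≤ f i) → 0ℚ ≤ sumFin m f
0≤sumFin {zero}  f f≥0 = ≤-refl
0≤sumFin {suc m} f f≥0 = +-mono-≤ (f≥0 zero) (0≤sumFin (f ∘ suc) (f≥0 ∘ suc))

≤-sumFin : (f : Fin m → ℚ) → (∀ i → 0ℚ ≤ f i) → ∀ k → f k ≤ sumFin m f
≤-sumFin {suc m} f f≥0 zero = begin
  f zero                         ≡⟨ +-identityʳ (f zero) ⟨
  f zero + 0ℚ                    ≤⟨ +-monoʳ-≤ (f zero) (0≤sumFin (f ∘ suc) (f≥0 ∘ suc)) ⟩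
  f zero + sumFin m (f ∘ suc)    ∎
  where open ≤-Reasoning
≤-sumFin {suc m} f f≥0 (suc k) = begin
  f (suc k)                      ≡⟨ +-identityˡ (f (suc k)) ⟨
  0ℚ + f (suc k)                 ≤⟨ +-mono-≤ (f≥0 zero) (≤-sumFin (f ∘ suc) (f≥0 ∘ suc) k) ⟩
  f zero + sumFin m (f ∘ suc)    ∎
  where open ≤-Reasoning

*-cancelʳ-≡ : ∀ {p q r} → r ≢ 0ℚ → p * r ≡ q * r → p ≡ q
*-cancelʳ-≡ {p} {q} {r} r≢0 pr≡qr = begin
  p                   ≡⟨ *-identityʳ p ⟨
  p * 1ℚ              ≡⟨ cong (p *_) (*-inverseʳ r) ⟨
  p * (r * 1/ r)      ≡⟨ *-assoc p r (1/ r) ⟨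
  p * r * 1/ r        ≡⟨ cong (_* 1/ r) pr≡qr ⟩
  q * r * 1/ r        ≡⟨ *-assoc q r (1/ r) ⟩
  q * (r * 1/ r)      ≡⟨ cong (q *_) (*-inverseʳ r) ⟩
  q * 1ℚ              ≡⟨ *-identityʳ q ⟩
  q                   ∎
  where
  open ≡-Reasoning
  instance
    r-nonZero : NonZero r
    r-nonZero = ≢-nonZero r≢0

-- true encodes the sign −1, so that sgn turns xor into multiplication.
sgn : Bool → ℚ
sgn false = 1ℚ
sgn true  = - 1ℚ

sgn-xor : ∀ a b → sgn (a xor b) ≡ sgn a * sgn b
sgn-xor false false = refl
sgn-xor false true  = refl
sgn-xor true  false = refl
sgn-xor true  true  = refl

sgn-*-sgn : ∀ a → sgn a * sgn a ≡ 1ℚ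
sgn-*-sgn a = trans (sym (sgn-xor a a)) (cong sgn (xor-same a))

sgn-injective : ∀ {a b} → sgn a ≡ sgn b → a ≡ b
sgn-injective {false} {false} _ = refl
sgn-injective {true}  {true}  _ = refl
sgn-injective {false} {true}  ()
sgn-injective {true}  {false} ()

sgn-ratio : ∀ a b c → sgn a ≡ c * sgn b → sgn (a xor b) ≡ c
sgn-ratio a b c a≡cb = begin
  sgn (a xor b)            ≡⟨ sgn-xor a b ⟩
  sgn a * sgn b            ≡⟨ cong (_* sgn b) a≡cb ⟩
  c * sgn b * sgn b        ≡⟨ *-assoc c (sgn b) (sgn b) ⟩
  c * (sgn b * sgn b)      ≡⟨ cong (c *_) (sgn-*-sgn b) ⟩
  c * 1ℚ                   ≡⟨ *-identityʳ c ⟩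
  c                        ∎
  where open ≡-Reasoning

sgn-*-involutive : ∀ a p → sgn a * (sgn a * p) ≡ p
sgn-*-involutive a p = begin
  sgn a * (sgn a * p)      ≡⟨ *-assoc (sgn a) (sgn a) p ⟨
  sgn a * sgn a * p        ≡⟨ cong (_* p) (sgn-*-sgn a) ⟩
  1ℚ * p                   ≡⟨ *-identityˡ p ⟩
  p                        ∎
  where open ≡-Reasoning

sgn-*-sum : ∀ a b₁ b₂ b₃ →
  sgn a * (sgn b₁ + (sgn b₂ + sgn b₃)) ≡ sgn (a xor b₁) + (sgn (a xor b₂) + sgn (a xor b₃))
sgn-*-sum a b₁ b₂ b₃ = begin
  sgn a * (sgn b₁ + (sgn b₂ + sgn b₃))                    ≡⟨ *-distribˡ-+ (sgn a) _ _ ⟩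
  sgn a * sgn b₁ + sgn a * (sgn b₂ + sgn b₃)              ≡⟨ cong (sgn a * sgn b₁ +_) (*-distribˡ-+ (sgn a) _ _) ⟩
  sgn a * sgn b₁ + (sgn a * sgn b₂ + sgn a * sgn b₃)      ≡⟨ sym (cong₂ _+_ (sgn-xor a b₁) (cong₂ _+_ (sgn-xor a b₂) (sgn-xor a b₃))) ⟩
  sgn (a xor b₁) + (sgn (a xor b₂) + sgn (a xor b₃))      ∎
  where open ≡-Reasoning

sgn-decomposition : ∀ q (q<?0 : Dec (q < 0ℚ)) → q ≡ sgn (does q<?0) * ∣ q ∣
sgn-decomposition q (no q≮0) = begin
  q             ≡⟨ 0≤p⇒∣p∣≡p (≮⇒≥ q≮0) ⟨
  ∣ q ∣         ≡⟨ *-identityˡ ∣ q ∣ ⟨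
  1ℚ * ∣ q ∣    ∎
  where open ≡-Reasoning
sgn-decomposition q (yes q<0) with ∣p∣≡p∨∣p∣≡-p q
... | inj₁ ∣q∣≡q = ⊥-elim (<⇒≢ (≤-<-trans (∣p∣≡p⇒0≤p ∣q∣≡q) q<0) refl)
... | inj₂ ∣q∣≡-q = begin
  q               ≡⟨ -‿involutive q ⟨
  - (- q)         ≡⟨ cong -_ ∣q∣≡-q ⟨
  - ∣ q ∣         ≡⟨ -1*x≈-x ∣ q ∣ ⟨
  - 1ℚ * ∣ q ∣    ∎
  where open ≡-Reasoning

separates : (Fin m → Bool) → Fin m → Fin m → Bool
separates t x y = t x xor t y

xor-swap : ∀ a b c d → a xor c ≡ b xor d → a xor b ≡ c xor d
xor-swap a b c d ac≡bd = begin
  a xor b                    ≡⟨ solve 3 (λ a b c → a :+ b := (a :+ c) :+ (b :+ c)) refl a b c ⟩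
  (a xor c) xor (b xor c)    ≡⟨ cong (_xor (b xor c)) ac≡bd ⟩
  (b xor d) xor (b xor c)    ≡⟨ solve 3 (λ b c d → (b :+ d) :+ (b :+ c) := c :+ d) refl b c d ⟩
  c xor d                    ∎
  where
  open ≡-Reasoning
  open xor-∧-Solver

xor-interchange : ∀ a b c d → (a xor b) xor (c xor d) ≡ (a xor c) xor (b xor d)
xor-interchange = solve 4 (λ a b c d → (a :+ b) :+ (c :+ d) := (a :+ c) :+ (b :+ d)) refl
  where open xor-∧-Solver

xor-≡ˡ⇒≡false : ∀ a b → a xor b ≡ a → b ≡ false
xor-≡ˡ⇒≡false false b     ab≡a = ab≡a
xor-≡ˡ⇒≡false true  false _    = refl
xor-≡ˡ⇒≡false true  true  ()

xor≡true⇒≢ : ∀ a b → a xor b ≡ true → a ≢ b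
xor≡true⇒≢ a .a aa≡true refl with trans (sym (xor-same a)) aa≡true
... | ()

module _ (X : Graph) where

  mulVec-cong : {v w : Fin (n X) → ℚ} → v ≗ w → mulVec X v ≗ mulVec X w
  mulVec-cong v≗w i = sumFin-cong (λ j → cong (adjMatrix X i j *_) (v≗w j))

  mulVec-*ʳ : ∀ c (v : Fin (n X) → ℚ) i → mulVec X (λ j → v j * c) i ≡ mulVec X v i * c
  mulVec-*ʳ c v i = trans (sumFin-cong (λ j → sym (*-assoc (adjMatrix X i j) (v j) c)))
                          (sumFin-*ʳ c (λ j → adjMatrix X i j * v j))

  mulVec-∘automorphism : ∀ σ → IsAutomorphism X σ → ∀ v i →
    mulVec X (v ∘ (σ ⟨$⟩ʳ_)) i ≡ mulVec X v (σ ⟨$⟩ʳ i)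
  mulVec-∘automorphism σ σ-aut v i = begin
    sumFin (n X) (λ j → adjMatrix X i j * v (σ ⟨$⟩ʳ j))
      ≡⟨ sumFin-cong (λ j → cong (λ b → (if b then 1ℚ else 0ℚ) * v (σ ⟨$⟩ʳ j)) (σ-aut i j)) ⟨
    sumFin (n X) (λ j → adjMatrix X (σ ⟨$⟩ʳ i) (σ ⟨$⟩ʳ j) * v (σ ⟨$⟩ʳ j))
      ≡⟨ sumFin-permute (λ j → adjMatrix X (σ ⟨$⟩ʳ i) j * v j) σ ⟩
    sumFin (n X) (λ j → adjMatrix X (σ ⟨$⟩ʳ i) j * v j)
      ∎
    where open ≡-Reasoning

  eigen-∘automorphism : ∀ σ {λ' v} → IsAutomorphism X σ → InEigenspace X λ' v →
    InEigenspace X λ' (v ∘ (σ ⟨$⟩ʳ_))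
  eigen-∘automorphism σ {v = v} σ-aut v-eigen i =
    trans (mulVec-∘automorphism σ σ-aut v i) (v-eigen (σ ⟨$⟩ʳ i))

record SignEigenvector (X : Graph) (λ' : ℚ) : Set where
  field
    signs : Fin (n X) → Bool
    eigen : InEigenspace X λ' (sgn ∘ signs)
    spans : ∀ w → InEigenspace X λ' w → ∃ λ c → ∀ i → w i ≡ c * sgn (signs i)

  same-cut : ∀ t → InEigenspace X λ' (sgn ∘ t) → ∀ i j → separates t i j ≡ separates signs i j
  same-cut t t-eigen i j with spans (sgn ∘ t) t-eigen
  ... | c , t≡c·signs = xor-swap (t i) (t j) (signs i) (signs j) (sgn-injective
    (trans (sgn-ratio (t i) (signs i) c (t≡c·signs i)) (sym (sgn-ratio (t j) (signs j) c (t≡c·signs j)))))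

  separates-automorphism : ∀ σ → IsAutomorphism X σ → ∀ i j →
    separates signs (σ ⟨$⟩ʳ i) (σ ⟨$⟩ʳ j) ≡ separates signs i j
  separates-automorphism σ σ-aut = same-cut (signs ∘ (σ ⟨$⟩ʳ_)) (eigen-∘automorphism X σ {λ'} σ-aut eigen)

module _ {X : Graph} {λ' : ℚ} where

  ∣∣-automorphism-invariant : (simple : SimpleEigenvalue X λ') → ∀ σ → IsAutomorphism X σ → ∀ i →
    ∣ proj₁ simple (σ ⟨$⟩ʳ i) ∣ ≡ ∣ proj₁ simple i ∣
  ∣∣-automorphism-invariant (v , (k , vk≢0) , eig , span) σ σ-aut i
    with span (v ∘ (σ ⟨$⟩ʳ_)) (eigen-∘automorphism X σ {λ'} σ-aut eig)
  ... | c , vσ≡cv = begin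
    ∣ v (σ ⟨$⟩ʳ i) ∣    ≡⟨ cong ∣_∣ (vσ≡cv i) ⟩
    ∣ c * v i ∣         ≡⟨ ∣p*q∣≡∣p∣*∣q∣ c (v i) ⟩
    ∣ c ∣ * ∣ v i ∣     ≡⟨ cong (_* ∣ v i ∣) ∣c∣≡1 ⟩
    1ℚ * ∣ v i ∣        ≡⟨ *-identityˡ ∣ v i ∣ ⟩
    ∣ v i ∣             ∎
    where
    open ≡-Reasoning
    ∣v∣ : Fin (n X) → ℚ
    ∣v∣ j = ∣ v j ∣
    total≢0 : sumFin (n X) ∣v∣ ≢ 0ℚ
    total≢0 total≡0 = vk≢0 (∣p∣≡0⇒p≡0 (v k)
      (≤-antisym (subst (∣ v k ∣ ≤_) total≡0 (≤-sumFin ∣v∣ (0≤∣p∣ ∘ v) k)) (0≤∣p∣ (v k))))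
    ∣c∣≡1 : ∣ c ∣ ≡ 1ℚ
    ∣c∣≡1 = *-cancelʳ-≡ total≢0 (begin
      ∣ c ∣ * sumFin (n X) ∣v∣                   ≡⟨ sumFin-*ˡ ∣ c ∣ ∣v∣ ⟨
      sumFin (n X) (λ j → ∣ c ∣ * ∣ v j ∣)        ≡⟨ sumFin-cong (λ j → trans (sym (∣p*q∣≡∣p∣*∣q∣ c (v j))) (cong ∣_∣ (sym (vσ≡cv j)))) ⟩
      sumFin (n X) (∣v∣ ∘ (σ ⟨$⟩ʳ_))             ≡⟨ sumFin-permute ∣v∣ σ ⟩
      sumFin (n X) ∣v∣                           ≡⟨ *-identityˡ _ ⟨
      1ℚ * sumFin (n X) ∣v∣                      ∎)

  ∣∣-constant : VertexTransitive X → (simple : SimpleEigenvalue X λ') → ∀ i j →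
    ∣ proj₁ simple i ∣ ≡ ∣ proj₁ simple j ∣
  ∣∣-constant vt simple i j with vt j i
  ... | σ , σ-aut , σj≡i = trans (cong (λ k → ∣ proj₁ simple k ∣) (sym σj≡i)) (∣∣-automorphism-invariant simple σ σ-aut j)

  signEigenvector : VertexTransitive X → SimpleEigenvalue X λ' → SignEigenvector X λ'
  signEigenvector vt simple@(v , (k , vk≢0) , eig , span) = record
    { signs = signs ; eigen = eigen ; spans = spans }
    where
    open ≡-Reasoning
    a : ℚ
    a = ∣ v k ∣
    signs : Fin (n X) → Bool
    signs i = does (v i <? 0ℚ)
    v≡signs·a : ∀ i → v i ≡ sgn (signs i) * a
    v≡signs·a i = trans (sgn-decomposition (v i) (v i <? 0ℚ)) (cong (sgn (signs i) *_) (∣∣-constant vt simple i k))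
    eigen : InEigenspace X λ' (sgn ∘ signs)
    eigen i = *-cancelʳ-≡ (vk≢0 ∘ ∣p∣≡0⇒p≡0 (v k)) (begin
      mulVec X (sgn ∘ signs) i * a             ≡⟨ mulVec-*ʳ X a (sgn ∘ signs) i ⟨
      mulVec X (λ j → sgn (signs j) * a) i     ≡⟨ mulVec-cong X v≡signs·a i ⟨
      mulVec X v i                             ≡⟨ eig i ⟩
      λ' * v i                                 ≡⟨ cong (λ' *_) (v≡signs·a i) ⟩
      λ' * (sgn (signs i) * a)                 ≡⟨ *-assoc λ' (sgn (signs i)) a ⟨
      λ' * sgn (signs i) * a                   ∎)
    spans : ∀ w → InEigenspace X λ' w → ∃ λ c → ∀ i → w i ≡ c * sgn (signs i)
    spans w w-eigen with span w w-eigen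
    ... | c , w≡cv = c * a , λ i → begin
      w i                       ≡⟨ w≡cv i ⟩
      c * v i                   ≡⟨ cong (c *_) (trans (v≡signs·a i) (*-comm (sgn (signs i)) a)) ⟩
      c * (a * sgn (signs i))   ≡⟨ *-assoc c a (sgn (signs i)) ⟨
      c * a * sgn (signs i)     ∎

trues : ∀ m → (Fin m → Bool) → List (Fin m)
trues zero    f = []
trues (suc m) f = if f zero then zero ∷ later else later
  where
  later : List (Fin (suc m))
  later = map suc (trues m (f ∘ suc))

length-trues : ∀ m (f : Fin m → Bool) → length (trues m f) ≡ countTrue m f
length-trues zero    f = refl
length-trues (suc m) f with f zero
... | true  = cong suc (trans (length-map suc (trues m (f ∘ suc))) (length-trues m (f ∘ suc)))
... | false = trans (length-map suc (trues m (f ∘ suc))) (length-trues m (f ∘ suc))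

∈-trues⁺ : ∀ m (f : Fin m → Bool) {j} → f j ≡ true → j ∈ trues m f
∈-trues⁺ (suc m) f {zero}  fj rewrite fj = here refl
∈-trues⁺ (suc m) f {suc j} fj with f zero
... | true  = there (∈-map⁺ suc (∈-trues⁺ m (f ∘ suc) fj))
... | false = ∈-map⁺ suc (∈-trues⁺ m (f ∘ suc) fj)

∈-trues⁻ : ∀ m (f : Fin m → Bool) {j} → j ∈ trues m f → f j ≡ true
∈-later⁻ : ∀ m (f : Fin (suc m) → Bool) {j} → j ∈ map suc (trues m (f ∘ suc)) → f j ≡ true

∈-trues⁻ (suc m) f j∈ with f zero in f0 | j∈
... | true  | here refl = f0
... | true  | there j∈′ = ∈-later⁻ m f j∈′
... | false | j∈′ = ∈-later⁻ m f j∈′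

∈-later⁻ m f j∈ with ∈-map⁻ suc j∈
... | i , i∈ , refl = ∈-trues⁻ m (f ∘ suc) i∈

sumᴸ : List ℚ → ℚ
sumᴸ = foldr _+_ 0ℚ

sumFin-indicator : ∀ m (f : Fin m → Bool) (v : Fin m → ℚ) →
  sumFin m (λ j → (if f j then 1ℚ else 0ℚ) * v j) ≡ sumᴸ (map v (trues m f))
sumFin-indicator zero    f v = refl
sumFin-indicator (suc m) f v with f zero | sumFin-indicator m (f ∘ suc) (v ∘ suc)
... | true  | later = cong₂ _+_ (*-identityˡ (v zero)) (trans later (cong sumᴸ (map-∘ (trues m (f ∘ suc)))))
... | false | later = trans (cong₂ _+_ (*-zeroˡ (v zero)) (trans later (cong sumᴸ (map-∘ (trues m (f ∘ suc))))))
                            (+-identityˡ _)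

record Neighbourhood (X : Graph) (x : Fin (n X)) : Set where
  field
    y₁ y₂ y₃   : Fin (n X)
    adj₁       : adj X x y₁ ≡ true
    adj₂       : adj X x y₂ ≡ true
    adj₃       : adj X x y₃ ≡ true
    exhaustive : ∀ y → adj X x y ≡ true → y ≡ y₁ ⊎ y ≡ y₂ ⊎ y ≡ y₃
    mulVec-at  : ∀ v → mulVec X v x ≡ v y₁ + (v y₂ + v y₃)

  all-neighbours : {P : Fin (n X) → Set} → P y₁ → P y₂ → P y₃ → ∀ y → adj X x y ≡ true → P y
  all-neighbours p₁ p₂ p₃ y xy with exhaustive y xy
  ... | inj₁ refl        = p₁
  ... | inj₂ (inj₁ refl) = p₂
  ... | inj₂ (inj₂ refl) = p₃

  signSum : (Fin (n X) → Bool) → ℚ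
  signSum t = sgn (separates t x y₁) + (sgn (separates t x y₂) + sgn (separates t x y₃))

  eigen-at⇒signSum : ∀ λ' t → mulVec X (sgn ∘ t) x ≡ λ' * sgn (t x) → signSum t ≡ λ'
  eigen-at⇒signSum λ' t eigen-at = begin
    signSum t                                              ≡⟨ sgn-*-sum (t x) (t y₁) (t y₂) (t y₃) ⟨
    sgn (t x) * (sgn (t y₁) + (sgn (t y₂) + sgn (t y₃)))   ≡⟨ cong (sgn (t x) *_) (trans (sym (mulVec-at (sgn ∘ t))) eigen-at) ⟩
    sgn (t x) * (λ' * sgn (t x))                           ≡⟨ cong (sgn (t x) *_) (*-comm λ' (sgn (t x))) ⟩
    sgn (t x) * (sgn (t x) * λ')                           ≡⟨ sgn-*-involutive (t x) λ' ⟩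
    λ'                                                     ∎
    where open ≡-Reasoning

  signSum⇒eigen-at : ∀ λ' t → signSum t ≡ λ' → mulVec X (sgn ∘ t) x ≡ λ' * sgn (t x)
  signSum⇒eigen-at λ' t signSum≡λ' = begin
    mulVec X (sgn ∘ t) x              ≡⟨ mulVec-at (sgn ∘ t) ⟩
    Σ                                 ≡⟨ sgn-*-involutive (t x) Σ ⟨
    sgn (t x) * (sgn (t x) * Σ)       ≡⟨ cong (sgn (t x) *_) (trans (sgn-*-sum (t x) (t y₁) (t y₂) (t y₃)) signSum≡λ') ⟩
    sgn (t x) * λ'                    ≡⟨ *-comm (sgn (t x)) λ' ⟩
    λ' * sgn (t x)                    ∎
    where
    open ≡-Reasoning
    Σ : ℚ
    Σ = sgn (t y₁) + (sgn (t y₂) + sgn (t y₃))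

neighbourhood : ∀ {X} → Cubic X → ∀ x → Neighbourhood X x
neighbourhood {X} cubic x =
  fromList (trues (n X) (adj X x)) (trans (length-trues (n X) (adj X x)) (cubic x))
           (λ y → ∈-trues⁺ (n X) (adj X x)) (∈-trues⁻ (n X) (adj X x)) (sumFin-indicator (n X) (adj X x))
  where
  fromList : (ys : List (Fin (n X))) → length ys ≡ 3 →
    (∀ y → adj X x y ≡ true → y ∈ ys) → (∀ {y} → y ∈ ys → adj X x y ≡ true) →
    (∀ v → mulVec X v x ≡ sumᴸ (map v ys)) → Neighbourhood X x
  fromList (y₁ ∷ y₂ ∷ y₃ ∷ []) _ complete sound mulVec≡ = record
    { y₁ = y₁ ; y₂ = y₂ ; y₃ = y₃
    ; adj₁ = sound (here refl) ; adj₂ = sound (there (here refl)) ; adj₃ = sound (there (there (here refl)))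
    ; exhaustive = λ y xy → member (complete y xy)
    ; mulVec-at = λ v → trans (mulVec≡ v) (cong (λ s → v y₁ + (v y₂ + s)) (+-identityʳ (v y₃)))
    }
    where
    member : ∀ {y} → y ∈ y₁ ∷ y₂ ∷ y₃ ∷ [] → y ≡ y₁ ⊎ y ≡ y₂ ⊎ y ≡ y₃
    member (here y≡y₁)                 = inj₁ y≡y₁
    member (there (here y≡y₂))         = inj₂ (inj₁ y≡y₂)
    member (there (there (here y≡y₃))) = inj₂ (inj₂ y≡y₃)

data ExactlyOne : Bool → Bool → Bool → Set where
  only₁ : ExactlyOne true false false
  only₂ : ExactlyOne false true false
  only₃ : ExactlyOne false false true

data ExactlyTwo : Bool → Bool → Bool → Set where
  except₁ : ExactlyTwo false true true
  except₂ : ExactlyTwo true false true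
  except₃ : ExactlyTwo true true false

ExactlyOne-resp : ∀ {a b c a′ b′ c′} → a ≡ a′ → b ≡ b′ → c ≡ c′ → ExactlyOne a b c → ExactlyOne a′ b′ c′
ExactlyOne-resp refl refl refl exactlyOne = exactlyOne

AllTrue : Bool → Bool → Bool → Set
AllTrue a b c = a ≡ true × b ≡ true × c ≡ true

sgn-sum≡1⇒ExactlyOne : ∀ a b c → sgn a + (sgn b + sgn c) ≡ 1ℚ → ExactlyOne a b c
sgn-sum≡1⇒ExactlyOne true  false false _ = only₁
sgn-sum≡1⇒ExactlyOne false true  false _ = only₂
sgn-sum≡1⇒ExactlyOne false false true  _ = only₃
sgn-sum≡1⇒ExactlyOne true  true  true  ()
sgn-sum≡1⇒ExactlyOne true  true  false ()
sgn-sum≡1⇒ExactlyOne true  false true  ()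
sgn-sum≡1⇒ExactlyOne false true  true  ()
sgn-sum≡1⇒ExactlyOne false false false ()

ExactlyOne⇒sgn-sum≡1 : ∀ {a b c} → ExactlyOne a b c → sgn a + (sgn b + sgn c) ≡ 1ℚ
ExactlyOne⇒sgn-sum≡1 only₁ = refl
ExactlyOne⇒sgn-sum≡1 only₂ = refl
ExactlyOne⇒sgn-sum≡1 only₃ = refl

sgn-sum≡-1⇒ExactlyTwo : ∀ a b c → sgn a + (sgn b + sgn c) ≡ - 1ℚ → ExactlyTwo a b c
sgn-sum≡-1⇒ExactlyTwo false true  true  _ = except₁
sgn-sum≡-1⇒ExactlyTwo true  false true  _ = except₂
sgn-sum≡-1⇒ExactlyTwo true  true  false _ = except₃
sgn-sum≡-1⇒ExactlyTwo true  true  true  ()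
sgn-sum≡-1⇒ExactlyTwo true  false false ()
sgn-sum≡-1⇒ExactlyTwo false true  false ()
sgn-sum≡-1⇒ExactlyTwo false false true  ()
sgn-sum≡-1⇒ExactlyTwo false false false ()

ExactlyOne⇒¬AllTrue : ∀ {a b c} → ExactlyOne a b c → ¬ AllTrue a b c
ExactlyOne⇒¬AllTrue only₁ (_ , () , _)
ExactlyOne⇒¬AllTrue only₂ (() , _)
ExactlyOne⇒¬AllTrue only₃ (() , _)

ExactlyOne-xor-ExactlyTwo : ∀ {u₁ u₂ u₃ w₁ w₂ w₃} → ExactlyOne u₁ u₂ u₃ → ExactlyTwo w₁ w₂ w₃ →
  AllTrue (u₁ xor w₁) (u₂ xor w₂) (u₃ xor w₃) ⊎ ExactlyOne (u₁ xor w₁) (u₂ xor w₂) (u₃ xor w₃)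
ExactlyOne-xor-ExactlyTwo only₁ except₁ = inj₁ (refl , refl , refl)
ExactlyOne-xor-ExactlyTwo only₁ except₂ = inj₂ only₃
ExactlyOne-xor-ExactlyTwo only₁ except₃ = inj₂ only₂
ExactlyOne-xor-ExactlyTwo only₂ except₁ = inj₂ only₃
ExactlyOne-xor-ExactlyTwo only₂ except₂ = inj₁ (refl , refl , refl)
ExactlyOne-xor-ExactlyTwo only₂ except₃ = inj₂ only₁
ExactlyOne-xor-ExactlyTwo only₃ except₁ = inj₂ only₂
ExactlyOne-xor-ExactlyTwo only₃ except₂ = inj₂ only₁
ExactlyOne-xor-ExactlyTwo only₃ except₃ = inj₁ (refl , refl , refl)

ProperAt : (X : Graph) → (Fin (n X) → Bool) → Fin (n X) → Set
ProperAt X t x = ∀ y → adj X x y ≡ true → separates t x y ≡ true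

properAt-transport : ∀ X t → VertexTransitive X →
  (∀ σ → IsAutomorphism X σ → ∀ x y → separates t (σ ⟨$⟩ʳ x) (σ ⟨$⟩ʳ y) ≡ separates t x y) →
  ∀ x z → ProperAt X t x → ProperAt X t z
properAt-transport X t vt invariant x z proper y zy with vt x z
... | σ , σ-aut , refl = begin
  separates t (σ ⟨$⟩ʳ x) y                      ≡⟨ cong (separates t (σ ⟨$⟩ʳ x)) (inverseʳ σ) ⟨
  separates t (σ ⟨$⟩ʳ x) (σ ⟨$⟩ʳ (σ ⟨$⟩ˡ y))    ≡⟨ invariant σ σ-aut x (σ ⟨$⟩ˡ y) ⟩
  separates t x (σ ⟨$⟩ˡ y)                      ≡⟨ proper (σ ⟨$⟩ˡ y) x-adj ⟩
  true                                          ∎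
  where
  open ≡-Reasoning
  x-adj : adj X x (σ ⟨$⟩ˡ y) ≡ true
  x-adj = trans (sym (σ-aut x (σ ⟨$⟩ˡ y))) (trans (cong (adj X (σ ⟨$⟩ʳ x)) (inverseʳ σ)) zy)

module Colouring (X : Graph) (cubic : Cubic X) (vt : VertexTransitive X)
                 (U : SignEigenvector X 1ℚ) (W : SignEigenvector X (- 1ℚ)) where

  private
    module U = SignEigenvector U
    module W = SignEigenvector W
    module N (x : Fin (n X)) = Neighbourhood (neighbourhood {X} cubic x)

  colour : Fin (n X) → Bool
  colour x = U.signs x xor W.signs x

  separates-colour : ∀ x y → separates colour x y ≡ separates U.signs x y xor separates W.signs x y
  separates-colour x y = xor-interchange (U.signs x) (W.signs x) (U.signs y) (W.signs y)

  separates-colour-automorphism : ∀ σ → IsAutomorphism X σ → ∀ x y →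
    separates colour (σ ⟨$⟩ʳ x) (σ ⟨$⟩ʳ y) ≡ separates colour x y
  separates-colour-automorphism σ σ-aut x y = begin
    separates colour (σ ⟨$⟩ʳ x) (σ ⟨$⟩ʳ y)
      ≡⟨ separates-colour (σ ⟨$⟩ʳ x) (σ ⟨$⟩ʳ y) ⟩
    separates U.signs (σ ⟨$⟩ʳ x) (σ ⟨$⟩ʳ y) xor separates W.signs (σ ⟨$⟩ʳ x) (σ ⟨$⟩ʳ y)
      ≡⟨ cong₂ _xor_ (U.separates-automorphism σ σ-aut x y) (W.separates-automorphism σ σ-aut x y) ⟩
    separates U.signs x y xor separates W.signs x y
      ≡⟨ separates-colour x y ⟨
    separates colour x y
      ∎
    where open ≡-Reasoning

  U-pattern : ∀ x → let open N x in
    ExactlyOne (separates U.signs x y₁) (separates U.signs x y₂) (separates U.signs x y₃)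
  U-pattern x = sgn-sum≡1⇒ExactlyOne _ _ _ (N.eigen-at⇒signSum x 1ℚ U.signs (U.eigen x))

  W-pattern : ∀ x → let open N x in
    ExactlyTwo (separates W.signs x y₁) (separates W.signs x y₂) (separates W.signs x y₃)
  W-pattern x = sgn-sum≡-1⇒ExactlyTwo _ _ _ (N.eigen-at⇒signSum x (- 1ℚ) W.signs (W.eigen x))

  local-dichotomy : ∀ x → let open N x in
    ProperAt X colour x ⊎ ExactlyOne (separates colour x y₁) (separates colour x y₂) (separates colour x y₃)
  local-dichotomy x with ExactlyOne-xor-ExactlyTwo (U-pattern x) (W-pattern x)
  ... | inj₁ (sep₁ , sep₂ , sep₃) = inj₁ (N.all-neighbours x (to-colour sep₁) (to-colour sep₂) (to-colour sep₃))
    where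
    to-colour : ∀ {y} → separates U.signs x y xor separates W.signs x y ≡ true → separates colour x y ≡ true
    to-colour = trans (separates-colour x _)
  ... | inj₂ exactlyOne = inj₂ (ExactlyOne-resp (to-colour _) (to-colour _) (to-colour _) exactlyOne)
    where
    to-colour : ∀ y → separates U.signs x y xor separates W.signs x y ≡ separates colour x y
    to-colour y = sym (separates-colour x y)

  ExactlyOne⇒improper : ∀ x → let open N x in
    ExactlyOne (separates colour x y₁) (separates colour x y₂) (separates colour x y₃) → ¬ ProperAt X colour x
  ExactlyOne⇒improper x exactlyOne proper =
    ExactlyOne⇒¬AllTrue exactlyOne (proper y₁ adj₁ , proper y₂ adj₂ , proper y₃ adj₃)
    where open N x

  improper-everywhere : ∀ x → ¬ ProperAt X colour x → ∀ z → let open N z in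
    ExactlyOne (separates colour z y₁) (separates colour z y₂) (separates colour z y₃)
  improper-everywhere x improper z with local-dichotomy z
  ... | inj₁ proper     = ⊥-elim (improper (properAt-transport X colour vt separates-colour-automorphism z x proper))
  ... | inj₂ exactlyOne = exactlyOne

  improper⇒colour-eigen : ∀ x → ¬ ProperAt X colour x → InEigenspace X 1ℚ (sgn ∘ colour)
  improper⇒colour-eigen x improper z =
    N.signSum⇒eigen-at z 1ℚ colour (ExactlyOne⇒sgn-sum≡1 (improper-everywhere x improper z))

  colour-eigen⇒W-constant : InEigenspace X 1ℚ (sgn ∘ colour) → ∀ x y → separates W.signs x y ≡ false
  colour-eigen⇒W-constant colour-eigen x y =
    xor-≡ˡ⇒≡false _ _ (trans (sym (separates-colour x y)) (U.same-cut colour colour-eigen x y))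

  W-nonconstant : ∀ x → ¬ (∀ y → separates W.signs x y ≡ false)
  W-nonconstant x W-constant = no-pattern (W-pattern x)
    where
    open N x
    no-pattern : ¬ ExactlyTwo (separates W.signs x y₁) (separates W.signs x y₂) (separates W.signs x y₃)
    no-pattern rewrite W-constant y₁ | W-constant y₂ | W-constant y₃ = λ ()

  colour-proper : ∀ x → ProperAt X colour x
  colour-proper x with local-dichotomy x
  ... | inj₁ proper     = proper
  ... | inj₂ exactlyOne = ⊥-elim (W-nonconstant x (colour-eigen⇒W-constant colour-eigen x))
    where
    colour-eigen : InEigenspace X 1ℚ (sgn ∘ colour)
    colour-eigen = improper⇒colour-eigen x (ExactlyOne⇒improper x exactlyOne)

theorem3p1 : (X : Graph) → Cubic X → VertexTransitive X →
    SimpleEigenvalue X 1ℚ → SimpleEigenvalue X (- 1ℚ) → Bipartite X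
theorem3p1 X cubic vt simple₁ simple₋₁ =
  colour , λ i j ij → xor≡true⇒≢ (colour i) (colour j) (colour-proper i j ij)
  where open Colouring X cubic vt (signEigenvector vt simple₁) (signEigenvector vt simple₋₁)
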